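{- Let $G$ be a graph with an $(a,b)$-DR-splittable decomposition into cycles of length $\ell$, where $|V(G)|/a$ is an even integer greater than two. Then $G\,\square\,G$ has a $(2a|V(G)|,\,b|V(G)|)$-DR-splittable decomposition into cycles of length $\ell$, in which each representing set has cardinality at least two.
   Context: Cartesian product $G\,\square\,H$: vertex set $V(G)\times V(H)$, $(u,v)(u',v')$ an edge iff ($u=u'$, $vv'\in E(H)$) or ($v=v'$, $uu'\in E(G)$). A decomposition of $G$ is a set of pairwise edge-disjoint subgraphs whose union is $G$. A set of graphs $\{G_1,\dots,G_a\}$ is a splittable decomposition of a graph $H$ if it is a decomposition of $H$ and there are pairwise disjoint sets $S_i\subseteq V(G_i)$ (representing sets) with $|S_1|=\dots=|S_a|\ge2$ and $\bigcup_i S_i=V(H)$. For $a,m\ge1$, a decomposition $\{G_1,\dots,G_{am}\}$ of $G$ is $a$-splittable if it can be partitioned into $m$ sets $\mathcal F_1,\dots,\mathcal F_m$ of $a$ graphs each, each $\mathcal F_i$ forming a splittable decomposition of a spanning subgraph of $G$. It is $(a,b)$-splittable if moreover each $\mathcal F_i$ can be partitioned into $a/b$ subsets each consisting of $b$ graphs that are pairwise vertex-disjoint and whose vertex sets together cover $V(G)$. Such a cycle decomposition is $(a,b)$-DR-splittable if additionally for every cycle $C$ with representing set $S$, traversing $C$ in a fixed direction, all paths between consecutive elements of $S$ have the same length. The length of a cycle is its number of edges. -}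

module Defs where

open import Level using (0ℓ)
open import Data.Nat using (ℕ; zero; suc; _+_; _*_; _≤_; _<_; NonZero)
open import Data.Nat.Base using (>-nonZero)
open import Data.Nat.DivMod using (_mod_)
open import Data.Fin using (Fin; toℕ)
open import Data.Fin.Subset using (Subset; _∈_; _∉_; ∣_∣)
open import Data.Product using (Σ; Σ-syntax; ∃; ∃-syntax; _×_; _,_)
open import Data.Sum using (_⊎_; inj₁; inj₂)
open import Data.Empty using (⊥)
open import Relation.Nullary using (¬_)
open import Relation.Binary.PropositionalEquality using (_≡_; _≢_; refl)
import Data.Nat.Properties
import Data.Nat
open import Function.Definitions using (Injective)

-- Finite simple graphs: a symmetric irreflexive adjacency relation on a
-- vertex type V.  For the theorem, V(G) = Fin n, so |V(G)| = n.

record Graph (V : Set) : Set₁ where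
  field
    Adj    : V → V → Set
    adj-sym : ∀ {u v} → Adj u v → Adj v u
    irrefl : ∀ {u} → ¬ Adj u u
open Graph public

_□_ : ∀ {V W} → Graph V → Graph W → Graph (V × W)
Adj (G □ H) (u , v) (u' , v') = (u ≡ u' × Adj H v v') ⊎ (v ≡ v' × Adj G u u')
Graph.adj-sym (G □ H) (inj₁ (refl , e)) = inj₁ (refl , Graph.adj-sym H e)
Graph.adj-sym (G □ H) (inj₂ (refl , e)) = inj₂ (refl , Graph.adj-sym G e)
Graph.irrefl (G □ H) (inj₁ (_ , e)) = Graph.irrefl H e
Graph.irrefl (G □ H) (inj₂ (_ , e)) = Graph.irrefl G e

-- A cycle of length ℓ in G, given with a fixed direction of traversal:
-- pairwise distinct vertices vert 0, …, vert (ℓ-1) with ℓ ≥ 3 and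
-- vert i adjacent to vert (i+1 mod ℓ).

module _ {V : Set} (G : Graph V) where

  record Cycle (ℓ : ℕ) : Set where
    field
      len≥3 : 3 ≤ ℓ
      vert  : Fin ℓ → V
      inj   : Injective _≡_ _≡_ vert
    instance
      ℓ-nonZero : NonZero ℓ
      ℓ-nonZero = >-nonZero (Data.Nat.Properties.<-≤-trans (Data.Nat.s≤s Data.Nat.z≤n) len≥3)
    pos : ℕ → Fin ℓ
    pos i = i mod ℓ
    at : ℕ → V
    at i = vert (pos i)
    field
      adj : ∀ (i : Fin ℓ) → Adj G (vert i) (at (suc (toℕ i)))

  open Cycle public

EdgeOf : ∀ {V} {G : Graph V} {ℓ} → Cycle G ℓ → V → V → Set
EdgeOf C u v = Σ[ i ∈ Fin _ ] ((vert C i ≡ u × at C (suc (toℕ i)) ≡ v)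
                              ⊎ (vert C i ≡ v × at C (suc (toℕ i)) ≡ u))

-- a family of cycles indexed by I is a decomposition of G: the cycles are
-- subgraphs of G (built into Cycle), every edge of G lies in some cycle,
-- and distinct cycles are edge-disjoint.
IsDecomposition : ∀ {V} (G : Graph V) {ℓ} {I : Set} → (I → Cycle G ℓ) → Set
IsDecomposition {V} G {I = I} C =
  (∀ u v → Adj G u v → Σ[ i ∈ I ] EdgeOf (C i) u v)
  × (∀ i j u v → EdgeOf (C i) u v → EdgeOf (C j) u v → i ≡ j)

-- DR condition for a cycle C with representing set S (as a set of
-- positions on C; its vertex set is the image under vert C, of the same
-- cardinality since vert C is injective): traversing C in its direction,
-- the path from each element of S to the next element of S has the same
-- length d.
IsDR : ∀ {V} {G : Graph V} {ℓ} (C : Cycle G ℓ) → Subset ℓ → Set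
IsDR C S = Σ[ d ∈ ℕ ] (1 ≤ d × (∀ p → p ∈ S →
             (pos C (toℕ p + d) ∈ S)
             × (∀ t → 1 ≤ t → t < d → pos C (toℕ p + t) ∉ S)))

-- The am cycles are indexed by Fin m × Fin q × Fin b with a = q * b:
-- class F_i = {C i j k | j, k}, and F_i is split into the q = a/b
-- subsets {C i j k | k}.  S i j k is the representing set of C i j k.

record DRSplittableCycleDecomposition {V : Set} (G : Graph V)
         (a b ℓ : ℕ) : Set where
  field
    m     : ℕ
    q     : ℕ
    a≥1   : 1 ≤ a
    m≥1   : 1 ≤ m
    a≡q*b : a ≡ q * b
    C     : Fin m → Fin q → Fin b → Cycle G ℓ
    S     : (i : Fin m) (j : Fin q) (k : Fin b) → Subset ℓ
    decomp : IsDecomposition G {I = Fin m × Fin q × Fin b}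
               (λ { (i , j , k) → C i j k })
    -- each F_i is a splittable decomposition (of a spanning subgraph):
    -- representing sets of equal size ≥ 2, pairwise disjoint, covering V
    size   : ∀ i → Σ[ s ∈ ℕ ] (2 ≤ s × (∀ j k → ∣ S i j k ∣ ≡ s))
    repDisj : ∀ i j k j' k' p p' → p ∈ S i j k → p' ∈ S i j' k' →
              vert (C i j k) p ≡ vert (C i j' k') p' →
              (j , k) ≡ (j' , k')
    repCover : ∀ i (v : V) → Σ[ j ∈ Fin q ] Σ[ k ∈ Fin b ]
               Σ[ p ∈ Fin ℓ ] (p ∈ S i j k × vert (C i j k) p ≡ v)
    -- each b-subset of F_i: pairwise vertex-disjoint cycles covering V
    grpDisj : ∀ i j k k' p p' → vert (C i j k) p ≡ vert (C i j k') p' → k ≡ k'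
    grpCover : ∀ i j (v : V) → Σ[ k ∈ Fin b ] Σ[ p ∈ Fin ℓ ] vert (C i j k) p ≡ v
    dr : ∀ i j k → IsDR (C i j k) (S i j k)

module Submission where

-- 1. A DR set with gap d on a cycle of length ℓ is exactly a residue class modulo d,
--    and d divides ℓ (isDR⇒residueClass).  Conversely every residue class modulo a
--    divisor of ℓ is a DR set (residues-isDR), and its size is ℓ/d (∣residues∣).
-- 2. The a representing sets of a class partition V(G); enumerating them shows
--    n = a·s, where s is their common size, so s = 2K and ℓ = K·(2d) for the gap d.
-- 3. Each representing set therefore splits into two residue classes modulo 2d of size
--    K ≥ 2 (module Halves); every vertex v gets the side of its representative.
-- 4. Every cycle C of G is copied into each horizontal layer V × {w} and each vertical
--    layer {w} × V; these copies decompose G □ G (□-decomposition).  The horizontal copy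
--    through w is represented by the half of C's set on the side of w, the vertical one
--    by the other half, so (x , y) is represented exactly once: horizontally if x and y
--    lie on the same side, vertically otherwise.
-- 5. These conditions are collected in a Splitting with structured index sets, which is
--    turned into the required Fin-indexed decomposition by numbering (fromSplitting).

open import Defs
open import Data.Bool using (Bool; true; false; not; if_then_else_)
open import Data.Bool.Properties using (T-≡; not-¬; ¬-not) renaming (_≟_ to _≟ᵇ_)
import Data.Fin as Fin
open import Data.Fin using (Fin; toℕ; fromℕ<)
open import Data.Fin.Properties
  using (toℕ-fromℕ<; fromℕ<-cong; fromℕ<-toℕ; toℕ<n; toℕ-injective; *↔×; cantor-schröder-bernstein)
open import Data.Fin.Subset using (Subset; _∈_; _∉_; _⊆_; ∣_∣; Nonempty)
open import Data.Fin.Subset.Properties using (⊆-antisym; nonempty?; Empty-unique; ∣⊥∣≡0)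
open import Data.Nat
open import Data.Nat.DivMod
open import Data.Nat.Divisibility using (_∣_; divides; divides-refl; ∣m+n∣m⇒∣n; m%n≡0⇒n∣m; ∣⇒≤)
open import Data.Nat.Properties
open import Data.Product using (Σ-syntax; _×_; _,_; proj₁; proj₂)
open import Data.Product.Function.NonDependent.Propositional using (_×-↔_)
open import Data.Sum using (_⊎_; inj₁; inj₂)
open import Data.Vec using (tabulate)
open import Data.Vec.Properties using (lookup∘tabulate; []=⇒lookup; lookup⇒[]=)
open import Function using (_∘_; _↔_; Inverse; Injection; Injective; Equivalence; mk↔ₛ′)
open import Function.Construct.Identity using (↔-id)
open import Function.Properties.Inverse using (↔⇒↣; ↔-sym; ↔-trans)
open import Relation.Nullary using (¬_; yes; no; contradiction)
open import Relation.Binary.PropositionalEquality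
open ≡-Reasoning

-- Arithmetic of positions modulo ℓ.

toℕ-mod : ∀ x ℓ .{{_ : NonZero ℓ}} → toℕ (x mod ℓ) ≡ x % ℓ
toℕ-mod x ℓ = toℕ-fromℕ< (m%n<n x ℓ)

mod-cong : ∀ {x y ℓ} .{{_ : NonZero ℓ}} → x % ℓ ≡ y % ℓ → x mod ℓ ≡ y mod ℓ
mod-cong e = fromℕ<-cong _ _ e _ _

toℕ-mod-self : ∀ {ℓ} .{{_ : NonZero ℓ}} (p : Fin ℓ) → toℕ p mod ℓ ≡ p
toℕ-mod-self p =
  trans (fromℕ<-cong _ _ (m<n⇒m%n≡m (toℕ<n p)) _ (toℕ<n p)) (fromℕ<-toℕ p (toℕ<n p))

mod-+ : ∀ x y ℓ .{{_ : NonZero ℓ}} → (toℕ (x mod ℓ) + y) mod ℓ ≡ (x + y) mod ℓ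
mod-+ x y ℓ = mod-cong (begin
  (toℕ (x mod ℓ) + y) % ℓ         ≡⟨ cong (λ z → (z + y) % ℓ) (toℕ-mod x ℓ) ⟩
  (x % ℓ + y) % ℓ                 ≡⟨ %-distribˡ-+ (x % ℓ) y ℓ ⟩
  (x % ℓ % ℓ + y % ℓ) % ℓ         ≡⟨ cong (λ z → (z + y % ℓ) % ℓ) (m%n%n≡m%n x ℓ) ⟩
  (x % ℓ + y % ℓ) % ℓ             ≡⟨ %-distribˡ-+ x y ℓ ⟨
  (x + y) % ℓ                     ∎)

mod-cancel : ∀ a u {d} .{{_ : NonZero d}} → (a + u) % d ≡ a % d → d ∣ u
mod-cancel a u {d} e = ∣m+n∣m⇒∣n (divides ((a + u) / d) shifted) (divides (a / d) refl)
  where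
  shifted : a / d * d + u ≡ (a + u) / d * d
  shifted = +-cancelˡ-≡ (a % d) _ _ (begin
    a % d + (a / d * d + u)        ≡⟨ +-assoc (a % d) _ u ⟨
    a % d + a / d * d + u          ≡⟨ cong (_+ u) (m≡m%n+[m/n]*n a d) ⟨
    a + u                          ≡⟨ m≡m%n+[m/n]*n (a + u) d ⟩
    (a + u) % d + (a + u) / d * d  ≡⟨ cong (_+ (a + u) / d * d) e ⟩
    a % d + (a + u) / d * d        ∎)

residues : (ℓ d r : ℕ) .{{_ : NonZero d}} → Subset ℓ
residues ℓ d r = tabulate (λ p → toℕ p % d ≡ᵇ r)

module _ {ℓ d r : ℕ} .{{_ : NonZero d}} {p : Fin ℓ} where

  residues⇒ : p ∈ residues ℓ d r → toℕ p % d ≡ r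
  residues⇒ p∈ = ≡ᵇ⇒≡ _ r (Equivalence.from T-≡
    (trans (sym (lookup∘tabulate _ p)) ([]=⇒lookup p∈)))

  ⇒residues : toℕ p % d ≡ r → p ∈ residues ℓ d r
  ⇒residues e = lookup⇒[]= p _
    (trans (lookup∘tabulate _ p) (Equivalence.to T-≡ (≡⇒≡ᵇ _ r e)))

countBelow : (ℕ → Bool) → ℕ → ℕ
countBelow f zero    = 0
countBelow f (suc N) = (if f 0 then 1 else 0) + countBelow (f ∘ suc) N

countBelow-cong : ∀ N {f g} → (∀ i → i < N → f i ≡ g i) → countBelow f N ≡ countBelow g N
countBelow-cong zero    f≗g = refl
countBelow-cong (suc N) f≗g =
  cong₂ _+_ (cong (λ b → if b then 1 else 0) (f≗g 0 z<s))
            (countBelow-cong N (λ i i<N → f≗g (suc i) (s<s i<N)))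

countBelow-+ : ∀ A B f → countBelow f (A + B) ≡ countBelow f A + countBelow (λ i → f (A + i)) B
countBelow-+ zero    B f = refl
countBelow-+ (suc A) B f =
  trans (cong ((if f 0 then 1 else 0) +_) (countBelow-+ A B (f ∘ suc)))
        (sym (+-assoc (if f 0 then 1 else 0) (countBelow (f ∘ suc) A) _))

countBelow-≡ᵇ : ∀ D r → r < D → countBelow (_≡ᵇ r) D ≡ 1
countBelow-≡ᵇ (suc D) zero    _         = cong suc (noneBelow D)
  where
  noneBelow : ∀ N → countBelow (λ i → suc i ≡ᵇ 0) N ≡ 0
  noneBelow zero    = refl
  noneBelow (suc N) = noneBelow N
countBelow-≡ᵇ (suc D) (suc r) (s<s r<D) = countBelow-≡ᵇ D r r<D

countBelow-residue : ∀ c D r .{{_ : NonZero D}} → r < D → countBelow (λ i → i % D ≡ᵇ r) (c * D) ≡ c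
countBelow-residue zero    D r r<D = refl
countBelow-residue (suc c) D r r<D = begin
  countBelow f (D + c * D)                             ≡⟨ countBelow-+ D (c * D) f ⟩
  countBelow f D + countBelow (λ i → f (D + i)) (c * D) ≡⟨ cong₂ _+_ firstBlock laterBlocks ⟩
  1 + c                                                ∎
  where
  f : ℕ → Bool
  f i = i % D ≡ᵇ r
  firstBlock : countBelow f D ≡ 1
  firstBlock = trans (countBelow-cong D (λ i i<D → cong (_≡ᵇ r) (m<n⇒m%n≡m i<D)))
                     (countBelow-≡ᵇ D r r<D)
  laterBlocks : countBelow (λ i → f (D + i)) (c * D) ≡ c
  laterBlocks = trans (countBelow-cong (c * D) (λ i _ → cong (_≡ᵇ r) shift)) (countBelow-residue c D r r<D)
    where
    shift : ∀ {i} → (D + i) % D ≡ i % D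
    shift {i} = trans (cong (_% D) (+-comm D i)) ([m+n]%n≡m%n i D)

∣tabulate∣ : ∀ N (f : ℕ → Bool) → ∣ tabulate {n = N} (f ∘ toℕ) ∣ ≡ countBelow f N
∣tabulate∣ zero    f = refl
∣tabulate∣ (suc N) f with f 0
... | true  = cong suc (∣tabulate∣ N (f ∘ suc))
... | false = ∣tabulate∣ N (f ∘ suc)

∣residues∣ : ∀ {ℓ} c d r .{{_ : NonZero d}} → ℓ ≡ c * d → r < d → ∣ residues ℓ d r ∣ ≡ c
∣residues∣ {ℓ} c d r refl r<d = trans (∣tabulate∣ ℓ (λ i → i % d ≡ᵇ r)) (countBelow-residue c d r r<d)

residues-isDR : ∀ {V} {G : Graph V} {ℓ} (C : Cycle G ℓ) d .{{_ : NonZero d}} r → d ∣ ℓ →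
                IsDR C (residues ℓ d r)
residues-isDR {ℓ = ℓ} C d r d∣ℓ = d , >-nonZero⁻¹ d , λ p p∈ → step p p∈ , gap p p∈
  where
  instance
    ℓ≢0 : NonZero ℓ
    ℓ≢0 = ℓ-nonZero C

  residue-mod : ∀ x → toℕ (x mod ℓ) % d ≡ x % d
  residue-mod x = trans (cong (_% d) (toℕ-mod x ℓ)) (m∣n⇒o%n%m≡o%m d ℓ x d∣ℓ)

  step : ∀ p → p ∈ residues ℓ d r → (toℕ p + d) mod ℓ ∈ residues ℓ d r
  step p p∈ = ⇒residues (trans (residue-mod _) (trans ([m+n]%n≡m%n (toℕ p) d) (residues⇒ p∈)))

  gap : ∀ p → p ∈ residues ℓ d r → ∀ t → 1 ≤ t → t < d → (toℕ p + t) mod ℓ ∉ residues ℓ d r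
  gap p p∈ t 1≤t t<d p+t∈ = <⇒≱ t<d (∣⇒≤ {{>-nonZero 1≤t}} d∣t)
    where
    d∣t : d ∣ t
    d∣t = mod-cancel (toℕ p) t (trans (sym (residue-mod _)) (trans (residues⇒ p+t∈) (sym (residues⇒ p∈))))

-- Conversely, a nonempty DR set with gap d on a cycle of length ℓ is a residue class
-- modulo d and d divides ℓ: starting from a member p₀, the members are exactly the
-- positions p₀ + t with d ∣ t.
module DRSet {ℓ d : ℕ} .{{_ : NonZero ℓ}} .{{_ : NonZero d}} (S : Subset ℓ)
  (step : ∀ p → p ∈ S → (toℕ p + d) mod ℓ ∈ S)
  (gap : ∀ p → p ∈ S → ∀ t → 1 ≤ t → t < d → (toℕ p + t) mod ℓ ∉ S)
  (p₀ : Fin ℓ) (p₀∈S : p₀ ∈ S) where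

  orbit : ∀ x → (toℕ p₀ + x * d) mod ℓ ∈ S
  orbit zero    = subst (_∈ S) (sym (trans (cong (_mod ℓ) (+-identityʳ (toℕ p₀))) (toℕ-mod-self p₀))) p₀∈S
  orbit (suc x) = subst (_∈ S) (trans (mod-+ _ d ℓ) (cong (_mod ℓ) reassoc)) (step _ (orbit x))
    where
    reassoc : toℕ p₀ + x * d + d ≡ toℕ p₀ + suc x * d
    reassoc = trans (+-assoc (toℕ p₀) (x * d) d) (cong (toℕ p₀ +_) (+-comm (x * d) d))

  divides⇒∈ : ∀ t → d ∣ t → (toℕ p₀ + t) mod ℓ ∈ S
  divides⇒∈ .(x * d) (divides-refl x) = orbit x

  -- a member p₀ + t with t ≢ 0 (mod d) would lie strictly inside a gap of the orbit
  ∈⇒divides : ∀ t → (toℕ p₀ + t) mod ℓ ∈ S → d ∣ t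
  ∈⇒divides t p₀+t∈S with t % d ≟ 0
  ... | yes t%d≡0 = m%n≡0⇒n∣m t d t%d≡0
  ... | no  t%d≢0 = contradiction (subst (_∈ S) (sym sameMember) p₀+t∈S)
                                  (gap _ (orbit (t / d)) (t % d) (n≢0⇒n>0 t%d≢0) (m%n<n t d))
    where
    sameMember : (toℕ ((toℕ p₀ + t / d * d) mod ℓ) + t % d) mod ℓ ≡ (toℕ p₀ + t) mod ℓ
    sameMember = trans (mod-+ _ (t % d) ℓ) (cong (_mod ℓ) (begin
      toℕ p₀ + t / d * d + t % d   ≡⟨ +-assoc (toℕ p₀) _ _ ⟩
      toℕ p₀ + (t / d * d + t % d) ≡⟨ cong (toℕ p₀ +_) (+-comm (t / d * d) (t % d)) ⟩
      toℕ p₀ + (t % d + t / d * d) ≡⟨ cong (toℕ p₀ +_) (m≡m%n+[m/n]*n t d) ⟨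
      toℕ p₀ + t                   ∎))

  -- walking once around the cycle returns to p₀, so d ∣ ℓ
  d∣ℓ : d ∣ ℓ
  d∣ℓ = ∈⇒divides ℓ (subst (_∈ S) (sym wrap) p₀∈S)
    where
    wrap : (toℕ p₀ + ℓ) mod ℓ ≡ p₀
    wrap = trans (mod-cong ([m+n]%n≡m%n (toℕ p₀) ℓ)) (toℕ-mod-self p₀)

  distance : Fin ℓ → ℕ
  distance p = (ℓ ∸ toℕ p₀) + toℕ p

  p₀+distance : ∀ p → toℕ p₀ + distance p ≡ ℓ + toℕ p
  p₀+distance p = trans (sym (+-assoc (toℕ p₀) _ _)) (cong (_+ toℕ p) (m+[n∸m]≡n (<⇒≤ (toℕ<n p₀))))

  reach : ∀ p → (toℕ p₀ + distance p) mod ℓ ≡ p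
  reach p = trans (mod-cong (trans (cong (_% ℓ) (trans (p₀+distance p) (+-comm ℓ (toℕ p))))
                                   ([m+n]%n≡m%n (toℕ p) ℓ)))
                  (toℕ-mod-self p)

  -- since d ∣ ℓ, the walk ends at the residue of p
  residue-distance : ∀ p → (toℕ p₀ + distance p) % d ≡ toℕ p % d
  residue-distance p = trans (cong (_% d) (p₀+distance p)) (%-remove-+ˡ (toℕ p) d∣ℓ)

  -- p ∈ S iff d divides its distance from p₀ iff p ≡ p₀ (mod d)
  S≡residues : S ≡ residues ℓ d (toℕ p₀ % d)
  S≡residues = ⊆-antisym S⊆ ⊆S
    where
    S⊆ : S ⊆ residues ℓ d (toℕ p₀ % d)
    S⊆ {p} p∈S = ⇒residues (begin
      toℕ p % d                     ≡⟨ residue-distance p ⟨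
      (toℕ p₀ + distance p) % d     ≡⟨ %-remove-+ʳ (toℕ p₀) (∈⇒divides _ (subst (_∈ S) (sym (reach p)) p∈S)) ⟩
      toℕ p₀ % d                    ∎)
    ⊆S : residues ℓ d (toℕ p₀ % d) ⊆ S
    ⊆S {p} p∈ = subst (_∈ S) (reach p)
      (divides⇒∈ _ (mod-cancel (toℕ p₀) _ (trans (residue-distance p) (residues⇒ p∈))))

record ResidueClass (ℓ : ℕ) (S : Subset ℓ) : Set where
  field
    period            : ℕ
    {{period≢0}}      : NonZero period
    residue           : ℕ
    residue<period    : residue < period
    ℓ≡size*period     : ℓ ≡ ∣ S ∣ * period
    S≡residues        : S ≡ residues ℓ period residue

nonempty : ∀ {ℓ} (S : Subset ℓ) → 1 ≤ ∣ S ∣ → Nonempty S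
nonempty {ℓ} S 1≤∣S∣ with nonempty? S
... | yes ne    = ne
... | no  empty = contradiction (trans (cong ∣_∣ (Empty-unique empty)) (∣⊥∣≡0 ℓ))
                                (≢-nonZero⁻¹ _ {{>-nonZero 1≤∣S∣}})

isDR⇒residueClass : ∀ {V} {G : Graph V} {ℓ} (C : Cycle G ℓ) {S : Subset ℓ} →
                    IsDR C S → Nonempty S → ResidueClass ℓ S
isDR⇒residueClass {ℓ = ℓ} C {S} (d , 1≤d , isDR) (p₀ , p₀∈S) = record
  { period         = d
  ; residue        = toℕ p₀ % d
  ; residue<period = m%n<n (toℕ p₀) d
  ; ℓ≡size*period  = ℓ≡∣S∣*d d∣ℓ
  ; S≡residues     = S≡residues
  }
  where
  instance
    ℓ≢0 : NonZero ℓ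
    ℓ≢0 = ℓ-nonZero C
    d≢0 : NonZero d
    d≢0 = >-nonZero 1≤d
  open DRSet S (λ p p∈ → proj₁ (isDR p p∈)) (λ p p∈ → proj₂ (isDR p p∈)) p₀ p₀∈S
  ℓ≡∣S∣*d : d ∣ ℓ → ℓ ≡ ∣ S ∣ * d
  ℓ≡∣S∣*d (divides c ℓ≡c*d) = trans ℓ≡c*d (cong (_* d) (sym (trans (cong ∣_∣ S≡residues)
                                 (∣residues∣ c d _ ℓ≡c*d (m%n<n (toℕ p₀) d)))))

-- The residue class r modulo d splits into the classes half true = r and
-- half false = r + d modulo 2d; lowerHalf x records which of the two contains x.
module Halves (d r : ℕ) .{{_ : NonZero d}} (r<d : r < d) where

  instance
    2d≢0 : NonZero (2 * d)
    2d≢0 = m*n≢0 2 d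

  half : Bool → ℕ
  half true  = r
  half false = r + d

  half<2d : ∀ e → half e < 2 * d
  half<2d true  = <-≤-trans r<d (m≤m+n d (d + 0))
  half<2d false = subst (r + d <_) (cong (d +_) (sym (+-identityʳ d))) (+-monoˡ-< d r<d)

  half-injective : ∀ {e e'} → half e ≡ half e' → e ≡ e'
  half-injective {true}  {true}  _ = refl
  half-injective {false} {false} _ = refl
  half-injective {true}  {false} r≡r+d =
    contradiction (+-cancelˡ-≡ r 0 d (trans (+-identityʳ r) r≡r+d)) (≢-nonZero⁻¹ d ∘ sym)
  half-injective {false} {true}  r+d≡r =
    contradiction (+-cancelˡ-≡ r d 0 (trans r+d≡r (sym (+-identityʳ r)))) (≢-nonZero⁻¹ d)

  mod-2d-mod-d : ∀ x → x % (2 * d) % d ≡ x % d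
  mod-2d-mod-d x = m∣n⇒o%n%m≡o%m d (2 * d) x (divides 2 refl)

  half⇒residue : ∀ x e → x % (2 * d) ≡ half e → x % d ≡ r
  half⇒residue x e x≡half = trans (sym (mod-2d-mod-d x)) (trans (cong (_% d) x≡half) (half-mod-d e))
    where
    half-mod-d : ∀ e → half e % d ≡ r
    half-mod-d true  = m<n⇒m%n≡m r<d
    half-mod-d false = trans ([m+n]%n≡m%n r d) (m<n⇒m%n≡m r<d)

  lowerHalf : ℕ → Bool
  lowerHalf x = x % (2 * d) ≡ᵇ r

  residue⇒half : ∀ x → x % d ≡ r → x % (2 * d) ≡ half (lowerHalf x)
  residue⇒half x x≡r with x % (2 * d) ≡ᵇ r in lower
  ... | true  = ≡ᵇ⇒≡ _ r (Equivalence.from T-≡ lower)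
  ... | false = begin
    y           ≡⟨ m∸n+n≡m d≤y ⟨
    y ∸ d + d   ≡⟨ cong (_+ d) y∸d≡r ⟩
    r + d       ∎
    where
    y = x % (2 * d)
    y%d≡r : y % d ≡ r
    y%d≡r = trans (mod-2d-mod-d x) x≡r
    y≢r : y ≢ r
    y≢r y≡r = contradiction (trans (sym (Equivalence.to T-≡ (≡⇒≡ᵇ y r y≡r))) lower) λ ()
    d≤y : d ≤ y
    d≤y with d ≤? y
    ... | yes d≤y = d≤y
    ... | no  d≰y = contradiction (trans (sym (m<n⇒m%n≡m (≰⇒> d≰y))) y%d≡r) y≢r
    y∸d<d : y ∸ d < d
    y∸d<d = subst (y ∸ d <_) (m+n∸m≡n d d)
              (∸-monoˡ-< (subst (y <_) (cong (d +_) (+-identityʳ d)) (m%n<n x (2 * d))) d≤y)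
    y∸d≡r : y ∸ d ≡ r
    y∸d≡r = trans (sym (m<n⇒m%n≡m y∸d<d)) (trans (m≤n⇒[n∸m]%m≡n%m d≤y) y%d≡r)

module Enumeration (ℓ s d r : ℕ) .{{_ : NonZero d}} (ℓ≡s*d : ℓ ≡ s * d) (r<d : r < d) where

  element<ℓ : (t : Fin s) → r + toℕ t * d < ℓ
  element<ℓ t = subst (r + toℕ t * d <_) (sym ℓ≡s*d)
                      (≤-trans (+-monoˡ-< (toℕ t * d) r<d) (*-monoˡ-≤ d (toℕ<n t)))

  element : Fin s → Fin ℓ
  element t = fromℕ< (element<ℓ t)

  element∈ : ∀ t → element t ∈ residues ℓ d r
  element∈ t = ⇒residues (trans (cong (_% d) (toℕ-fromℕ< (element<ℓ t)))
                               (trans ([m+kn]%n≡m%n r (toℕ t) d) (m<n⇒m%n≡m r<d)))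

  element-injective : Injective _≡_ _≡_ element
  element-injective {t} {t'} e = toℕ-injective (*-cancelʳ-≡ (toℕ t) (toℕ t') d (+-cancelˡ-≡ r _ _ (begin
    r + toℕ t * d         ≡⟨ toℕ-fromℕ< (element<ℓ t) ⟨
    toℕ (element t)       ≡⟨ cong toℕ e ⟩
    toℕ (element t')      ≡⟨ toℕ-fromℕ< (element<ℓ t') ⟩
    r + toℕ t' * d        ∎)))

  index<s : (p : Fin ℓ) → toℕ p / d < s
  index<s p = m<n*o⇒m/o<n (subst (toℕ p <_) ℓ≡s*d (toℕ<n p))

  index : Fin ℓ → Fin s
  index p = fromℕ< (index<s p)

  element-index : ∀ p → p ∈ residues ℓ d r → element (index p) ≡ p
  element-index p p∈ = toℕ-injective (begin
    toℕ (element (index p))       ≡⟨ toℕ-fromℕ< (element<ℓ (index p)) ⟩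
    r + toℕ (index p) * d         ≡⟨ cong (λ i → r + i * d) (toℕ-fromℕ< (index<s p)) ⟩
    r + toℕ p / d * d             ≡⟨ cong (_+ toℕ p / d * d) (residues⇒ p∈) ⟨
    toℕ p % d + toℕ p / d * d     ≡⟨ m≡m%n+[m/n]*n (toℕ p) d ⟨
    toℕ p                         ∎)

injections⇒≡ : ∀ {n N} {B : Set} → Fin N ↔ B →
               (f : Fin n → B) → Injective _≡_ _≡_ f → (g : B → Fin n) → Injective _≡_ _≡_ g → n ≡ N
injections⇒≡ numB f f-inj g g-inj =
  cantor-schröder-bernstein {f = Inverse.from numB ∘ f} {g = g ∘ Inverse.to numB}
    (λ e → f-inj (Injection.injective (↔⇒↣ (↔-sym numB)) e))
    (λ e → Injection.injective (↔⇒↣ numB) (g-inj e))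

edge-adj : ∀ {V} {G : Graph V} {ℓ} (C : Cycle G ℓ) {u v} → EdgeOf C u v → Adj G u v
edge-adj C (i , inj₁ (refl , refl)) = adj C i
edge-adj {G = G} C (i , inj₂ (refl , refl)) = adj-sym G (adj C i)

module _ {V W : Set} {G : Graph V} {H : Graph W} {ℓ : ℕ} where

  alongFirst : Cycle G ℓ → W → Cycle (G □ H) ℓ
  alongFirst C w = record
    { len≥3 = len≥3 C
    ; vert  = λ p → vert C p , w
    ; inj   = λ e → inj C (cong proj₁ e)
    ; adj   = λ p → inj₂ (refl , adj C p)
    }

  alongSecond : V → Cycle H ℓ → Cycle (G □ H) ℓ
  alongSecond v D = record
    { len≥3 = len≥3 D
    ; vert  = λ p → v , vert D p
    ; inj   = λ e → inj D (cong proj₂ e)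
    ; adj   = λ p → inj₁ (refl , adj D p)
    }

  alongFirst-edge : ∀ (C : Cycle G ℓ) w {x y : V × W} → EdgeOf (alongFirst C w) x y →
                    EdgeOf C (proj₁ x) (proj₁ y) × proj₂ x ≡ w × proj₂ y ≡ w
  alongFirst-edge C w (i , inj₁ (refl , refl)) = (i , inj₁ (refl , refl)) , refl , refl
  alongFirst-edge C w (i , inj₂ (refl , refl)) = (i , inj₂ (refl , refl)) , refl , refl

  alongSecond-edge : ∀ v (D : Cycle H ℓ) {x y : V × W} → EdgeOf (alongSecond v D) x y →
                     EdgeOf D (proj₂ x) (proj₂ y) × proj₁ x ≡ v × proj₁ y ≡ v
  alongSecond-edge v D (i , inj₁ (refl , refl)) = (i , inj₁ (refl , refl)) , refl , refl
  alongSecond-edge v D (i , inj₂ (refl , refl)) = (i , inj₂ (refl , refl)) , refl , refl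

  edge-alongFirst : ∀ (C : Cycle G ℓ) {u u'} w → EdgeOf C u u' → EdgeOf (alongFirst C w) (u , w) (u' , w)
  edge-alongFirst C w (i , inj₁ (refl , refl)) = i , inj₁ (refl , refl)
  edge-alongFirst C w (i , inj₂ (refl , refl)) = i , inj₂ (refl , refl)

  edge-alongSecond : ∀ (D : Cycle H ℓ) {v v'} u → EdgeOf D v v' → EdgeOf (alongSecond u D) (u , v) (u , v')
  edge-alongSecond D u (i , inj₁ (refl , refl)) = i , inj₁ (refl , refl)
  edge-alongSecond D u (i , inj₂ (refl , refl)) = i , inj₂ (refl , refl)

  productCycles : ∀ {I J : Set} → (I → Cycle G ℓ) → (J → Cycle H ℓ) → (I × W) ⊎ (V × J) → Cycle (G □ H) ℓ
  productCycles C D (inj₁ (i , w)) = alongFirst (C i) w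
  productCycles C D (inj₂ (v , j)) = alongSecond v (D j)

  □-decomposition : ∀ {I J : Set} {C : I → Cycle G ℓ} {D : J → Cycle H ℓ} →
                    IsDecomposition G C → IsDecomposition H D →
                    IsDecomposition (G □ H) (productCycles C D)
  □-decomposition {C = C} {D} (coverG , disjointG) (coverH , disjointH) = cover , disjoint
    where
    cover : ∀ x y → Adj (G □ H) x y → Σ[ c ∈ _ ] EdgeOf (productCycles C D c) x y
    cover (u , v) (.u , v') (inj₁ (refl , vv')) with coverH v v' vv'
    ... | j , e = inj₂ (u , j) , edge-alongSecond (D j) u e
    cover (u , v) (u' , .v) (inj₂ (refl , uu')) with coverG u u' uu'
    ... | i , e = inj₁ (i , v) , edge-alongFirst (C i) v e

    -- an edge inside a layer V × {w} joins distinct first coordinates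
    -- and so cannot lie in a layer {v} × W
    crossing : ∀ i w v j {x y} → EdgeOf (alongFirst (C i) w) x y → ¬ EdgeOf (alongSecond v (D j)) x y
    crossing i w v j e e' with alongFirst-edge (C i) w e | alongSecond-edge v (D j) e'
    ... | eG , _ | _ , refl , x₁≡y₁ = irrefl G (subst (Adj G _) x₁≡y₁ (edge-adj (C i) eG))

    disjoint : ∀ c c' x y → EdgeOf (productCycles C D c) x y → EdgeOf (productCycles C D c') x y → c ≡ c'
    disjoint (inj₁ (i , w)) (inj₁ (i' , w')) x y e e'
      with alongFirst-edge (C i) w e | alongFirst-edge (C i') w' e'
    ... | eG , refl , _ | eG' , refl , _ = cong (λ i → inj₁ (i , _)) (disjointG i i' _ _ eG eG')
    disjoint (inj₂ (v , j)) (inj₂ (v' , j')) x y e e'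
      with alongSecond-edge v (D j) e | alongSecond-edge v' (D j') e'
    ... | eH , refl , _ | eH' , refl , _ = cong (λ j → inj₂ (_ , j)) (disjointH j j' _ _ eH eH')
    disjoint (inj₁ (i , w)) (inj₂ (v , j)) x y e e' = contradiction e' (crossing i w v j e)
    disjoint (inj₂ (v , j)) (inj₁ (i , w)) x y e e' = contradiction e (crossing i w v j e')

reindex : ∀ {V} {G : Graph V} {ℓ} {I I' : Set} {C : I → Cycle G ℓ} (C' : I' → Cycle G ℓ)
          (f : I' ↔ I) → (∀ x → C' x ≡ C (Inverse.to f x)) →
          IsDecomposition G C → IsDecomposition G C'
reindex {G = G} {C = C} C' f C'≡C∘f (cover , disjoint) = cover' , disjoint'
  where
  open Inverse f
  cover' : ∀ u v → Adj G u v → Σ[ x ∈ _ ] EdgeOf (C' x) u v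
  cover' u v uv with cover u v uv
  ... | i , e = from i ,
    subst (λ c → EdgeOf c u v) (sym (trans (C'≡C∘f (from i)) (cong C (strictlyInverseˡ i)))) e
  disjoint' : ∀ x x' u v → EdgeOf (C' x) u v → EdgeOf (C' x') u v → x ≡ x'
  disjoint' x x' u v e e' = Injection.injective (↔⇒↣ f)
    (disjoint _ _ u v (subst (λ c → EdgeOf c u v) (C'≡C∘f x) e) (subst (λ c → EdgeOf c u v) (C'≡C∘f x') e'))

-- The layers of G □ G: a cycle of the new decomposition runs horizontally (its first
-- coordinate varies) or vertically (its second coordinate varies).
pattern horizontal = Fin.zero
pattern vertical   = Fin.suc Fin.zero

layers↔ : ∀ {I J K W : Set} → (I × (Fin 2 × J) × (K × W)) ↔ (((I × J × K) × W) ⊎ (W × (I × J × K)))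
layers↔ {I} {J} {K} {W} = mk↔ₛ′ split merge split∘merge merge∘split
  where
  split : I × (Fin 2 × J) × (K × W) → ((I × J × K) × W) ⊎ (W × (I × J × K))
  split (i , (horizontal , j) , (k , w)) = inj₁ ((i , j , k) , w)
  split (i , (vertical   , j) , (k , w)) = inj₂ (w , (i , j , k))
  merge : ((I × J × K) × W) ⊎ (W × (I × J × K)) → I × (Fin 2 × J) × (K × W)
  merge (inj₁ ((i , j , k) , w)) = i , (horizontal , j) , (k , w)
  merge (inj₂ (w , (i , j , k))) = i , (vertical   , j) , (k , w)
  split∘merge : ∀ x → split (merge x) ≡ x
  split∘merge (inj₁ _) = refl
  split∘merge (inj₂ _) = refl
  merge∘split : ∀ x → merge (split x) ≡ x
  merge∘split (_ , (horizontal , _) , _) = refl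
  merge∘split (_ , (vertical   , _) , _) = refl

-- The conditions defining a DR-splittable cycle decomposition, for classes indexed by
-- Fin m but with the cycles of a class indexed by arbitrary sets J (the subsets of b
-- cycles) and K (the cycles within such a subset).
record Splitting {V : Set} (G : Graph V) (ℓ m : ℕ) (J K : Set) : Set where
  field
    C        : Fin m → J → K → Cycle G ℓ
    S        : Fin m → J → K → Subset ℓ
    decomp   : IsDecomposition G {I = Fin m × J × K} (λ { (i , j , k) → C i j k })
    size     : ∀ i → Σ[ s ∈ ℕ ] (2 ≤ s × (∀ j k → ∣ S i j k ∣ ≡ s))
    repDisj  : ∀ i j k j' k' p p' → p ∈ S i j k → p' ∈ S i j' k' →
               vert (C i j k) p ≡ vert (C i j' k') p' → (j , k) ≡ (j' , k')
    repCover : ∀ i (v : V) → Σ[ j ∈ J ] Σ[ k ∈ K ] Σ[ p ∈ Fin ℓ ] (p ∈ S i j k × vert (C i j k) p ≡ v)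
    grpDisj  : ∀ i j k k' p p' → vert (C i j k) p ≡ vert (C i j k') p' → k ≡ k'
    grpCover : ∀ i j (v : V) → Σ[ k ∈ K ] Σ[ p ∈ Fin ℓ ] vert (C i j k) p ≡ v
    dr       : ∀ i j k → IsDR (C i j k) (S i j k)

fromSplitting : ∀ {V} {G : Graph V} {ℓ m q b a} {J K : Set} → Splitting G ℓ m J K →
                Fin q ↔ J → Fin b ↔ K → 1 ≤ a → 1 ≤ m → a ≡ q * b →
                DRSplittableCycleDecomposition G a b ℓ
fromSplitting {V} {ℓ = ℓ} {m} {q} {b} sp numJ numK a≥1 m≥1 a≡q*b = record
  { m        = m
  ; q        = q
  ; a≥1      = a≥1
  ; m≥1      = m≥1
  ; a≡q*b    = a≡q*b
  ; C        = λ i j k → C i (toJ j) (toK k)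
  ; S        = λ i j k → S i (toJ j) (toK k)
  ; decomp   = reindex {C = λ { (i , j , k) → C i j k }} (λ { (i , j , k) → C i (toJ j) (toK k) })
                       (↔-id _ ×-↔ (numJ ×-↔ numK)) (λ _ → refl) decomp
  ; size     = λ i → proj₁ (size i) , proj₁ (proj₂ (size i)) , λ j k → proj₂ (proj₂ (size i)) (toJ j) (toK k)
  ; repDisj  = λ i j k j' k' p p' p∈ p'∈ e → numbered-≡ (repDisj i _ _ _ _ p p' p∈ p'∈ e)
  ; repCover = repCover'
  ; grpDisj  = λ i j k k' p p' e → injectiveK (grpDisj i (toJ j) _ _ p p' e)
  ; grpCover = grpCover'
  ; dr       = λ i j k → dr i (toJ j) (toK k)
  }
  where
  open Splitting sp
  open Inverse numJ using () renaming (to to toJ; from to fromJ; strictlyInverseˡ to toJ-fromJ)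
  open Inverse numK using () renaming (to to toK; from to fromK; strictlyInverseˡ to toK-fromK)
  injectiveJ : Injective _≡_ _≡_ toJ
  injectiveJ = Injection.injective (↔⇒↣ numJ)
  injectiveK : Injective _≡_ _≡_ toK
  injectiveK = Injection.injective (↔⇒↣ numK)

  numbered-≡ : ∀ {j j' k k'} → (toJ j , toK k) ≡ (toJ j' , toK k') → (j , k) ≡ (j' , k')
  numbered-≡ e = cong₂ _,_ (injectiveJ (cong proj₁ e)) (injectiveK (cong proj₂ e))

  repCover' : ∀ i (v : V) → Σ[ j ∈ Fin q ] Σ[ k ∈ Fin b ] Σ[ p ∈ Fin ℓ ]
              (p ∈ S i (toJ j) (toK k) × vert (C i (toJ j) (toK k)) p ≡ v)
  repCover' i v with repCover i v
  ... | j , k , p , represents = fromJ j , fromK k , p ,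
        subst₂ (λ j k → p ∈ S i j k × vert (C i j k) p ≡ v)
               (sym (toJ-fromJ j)) (sym (toK-fromK k)) represents

  grpCover' : ∀ i j (v : V) → Σ[ k ∈ Fin b ] Σ[ p ∈ Fin ℓ ] vert (C i (toJ j) (toK k)) p ≡ v
  grpCover' i j v with grpCover i (toJ j) v
  ... | k , p , covers = fromK k , p , subst (λ k → vert (C i (toJ j) k) p ≡ v) (sym (toK-fromK k)) covers

module Construction {n a b ℓ : ℕ} {G : Graph (Fin n)} (dec : DRSplittableCycleDecomposition G a b ℓ)
                    (K : ℕ) (n≡2K*a : n ≡ (2 * K) * a) where

  open DRSplittableCycleDecomposition dec

  instance
    a≢0 : NonZero a
    a≢0 = >-nonZero a≥1

  s : Fin m → ℕ
  s i = proj₁ (size i)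

  ∣S∣≡s : ∀ i j k → ∣ S i j k ∣ ≡ s i
  ∣S∣≡s i j k = proj₂ (proj₂ (size i)) j k

  class : ∀ i j k → ResidueClass ℓ (S i j k)
  class i j k = isDR⇒residueClass (C i j k) (dr i j k)
    (nonempty (S i j k) (subst (1 ≤_) (sym (∣S∣≡s i j k)) (≤-trans (s≤s z≤n) (proj₁ (proj₂ (size i))))))

  module _ (i : Fin m) (j : Fin q) (k : Fin b) where
    open ResidueClass (class i j k) public using (period; residue; residue<period)

  instance
    period≢0 : ∀ {i j k} → NonZero (period i j k)
    period≢0 {i} {j} {k} = ResidueClass.period≢0 (class i j k)

  S≡residues : ∀ i j k → S i j k ≡ residues ℓ (period i j k) (residue i j k)
  S≡residues i j k = ResidueClass.S≡residues (class i j k)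

  toS : ∀ {i j k p} → p ∈ residues ℓ (period i j k) (residue i j k) → p ∈ S i j k
  toS {i} {j} {k} {p} = subst (p ∈_) (sym (S≡residues i j k))

  fromS : ∀ {i j k p} → p ∈ S i j k → p ∈ residues ℓ (period i j k) (residue i j k)
  fromS {i} {j} {k} {p} = subst (p ∈_) (S≡residues i j k)

  ℓ≡s*period : ∀ i j k → ℓ ≡ s i * period i j k
  ℓ≡s*period i j k = trans (ResidueClass.ℓ≡size*period (class i j k)) (cong (_* period i j k) (∣S∣≡s i j k))

  module _ (i : Fin m) (v : Fin n) where
    repJ : Fin q
    repJ = proj₁ (repCover i v)
    repK : Fin b
    repK = proj₁ (proj₂ (repCover i v))
    repPos : Fin ℓ
    repPos = proj₁ (proj₂ (proj₂ (repCover i v)))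
    repPos∈ : repPos ∈ S i repJ repK
    repPos∈ = proj₁ (proj₂ (proj₂ (proj₂ (repCover i v))))
    rep-vert : vert (C i repJ repK) repPos ≡ v
    rep-vert = proj₂ (proj₂ (proj₂ (proj₂ (repCover i v))))

  -- Counting V(G) through the representing sets of class i: these a sets of size s i
  -- partition V(G), so n = a · s i, and hence s i = 2K.

  module Enum (i : Fin m) (j : Fin q) (k : Fin b) =
    Enumeration ℓ (s i) (period i j k) (residue i j k) (ℓ≡s*period i j k) (residue<period i j k)

  Representative : Fin m → Set
  Representative i = (Fin q × Fin b) × Fin (s i)

  representative : ∀ i → Representative i → Fin n
  representative i ((j , k) , t) = vert (C i j k) (Enum.element i j k t)

  representative-injective : ∀ i → Injective _≡_ _≡_ (representative i)
  representative-injective i {(j , k) , t} {(j' , k') , t'} e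
    with refl ← repDisj i j k j' k' _ _ (toS (Enum.element∈ i j k t)) (toS (Enum.element∈ i j' k' t')) e
    = cong ((j , k) ,_) (Enum.element-injective i j k (inj (C i j k) e))

  locate : ∀ i → Fin n → Representative i
  locate i v = (repJ i v , repK i v) , Enum.index i (repJ i v) (repK i v) (repPos i v)

  same-location : ∀ i {j k p j' k' p'} → p ∈ S i j k → p' ∈ S i j' k' →
                  ((j , k) , Enum.index i j k p) ≡ ((j' , k') , Enum.index i j' k' p') →
                  vert (C i j k) p ≡ vert (C i j' k') p'
  same-location i {j} {k} {p} {j'} {k'} {p'} p∈ p'∈ e with refl ← cong proj₁ e =
    cong (vert (C i j k)) (begin
      p                                   ≡⟨ Enum.element-index i j k p (fromS p∈) ⟨
      Enum.element i j k (Enum.index i j k p)  ≡⟨ cong (Enum.element i j k) (cong proj₂ e) ⟩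
      Enum.element i j k (Enum.index i j k p') ≡⟨ Enum.element-index i j k p' (fromS p'∈) ⟩
      p'                                  ∎)

  locate-injective : ∀ i → Injective _≡_ _≡_ (locate i)
  locate-injective i {v} {v'} e = begin
    v                                                ≡⟨ rep-vert i v ⟨
    vert (C i (repJ i v) (repK i v)) (repPos i v)    ≡⟨ same-location i (repPos∈ i v) (repPos∈ i v') e ⟩
    vert (C i (repJ i v') (repK i v')) (repPos i v') ≡⟨ rep-vert i v' ⟩
    v'                                               ∎

  -- listing and locating are injective in both directions
  n≡a*s : ∀ i → n ≡ (q * b) * s i
  n≡a*s i = injections⇒≡ (↔-trans *↔× (*↔× ×-↔ ↔-id _))
                         (locate i) (locate-injective i) (representative i) (representative-injective i)

  s≡2K : ∀ i → s i ≡ 2 * K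
  s≡2K i = *-cancelˡ-≡ (s i) (2 * K) (q * b) {{subst NonZero a≡q*b a≢0}} (begin
    q * b * s i  ≡⟨ n≡a*s i ⟨
    n            ≡⟨ n≡2K*a ⟩
    2 * K * a    ≡⟨ *-comm (2 * K) a ⟩
    a * (2 * K)  ≡⟨ cong (_* (2 * K)) a≡q*b ⟩
    q * b * (2 * K) ∎)

  ℓ≡K*2period : ∀ i j k → ℓ ≡ K * (2 * period i j k)
  ℓ≡K*2period i j k = begin
    ℓ                         ≡⟨ ℓ≡s*period i j k ⟩
    s i * period i j k        ≡⟨ cong (_* period i j k) (trans (s≡2K i) (*-comm 2 K)) ⟩
    K * 2 * period i j k      ≡⟨ *-assoc K 2 (period i j k) ⟩
    K * (2 * period i j k)    ∎

  module Half (i : Fin m) (j : Fin q) (k : Fin b) =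
    Halves (period i j k) (residue i j k) (residue<period i j k)

  instance
    2period≢0 : ∀ {i j k} → NonZero (2 * period i j k)
    2period≢0 {i} {j} {k} = m*n≢0 2 (period i j k)

  lower : ∀ i j k → Fin ℓ → Bool
  lower i j k p = Half.lowerHalf i j k (toℕ p)

  side : Fin m → Fin n → Bool
  side i v = lower i (repJ i v) (repK i v) (repPos i v)

  side-unique : ∀ i {j k p j' k' p'} → p ∈ S i j k → p' ∈ S i j' k' →
                vert (C i j k) p ≡ vert (C i j' k') p' → lower i j k p ≡ lower i j' k' p'
  side-unique i {j} {k} {p} {j'} {k'} {p'} p∈ p'∈ e with refl ← repDisj i j k j' k' p p' p∈ p'∈ e =
    cong (lower i j k) (inj (C i j k) e)

  side-spec : ∀ i j k p → p ∈ S i j k → side i (vert (C i j k) p) ≡ lower i j k p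
  side-spec i j k p p∈ = side-unique i (repPos∈ i _) p∈ (rep-vert i _)

  -- New cycles: class i, subset (dir , j), cycle (k , w) is the copy of C i j k in the
  -- layer through w.  Its representing set is the half of S i j k selected by side i w
  -- (horizontal layers) or by its opposite (vertical layers).

  C' : Fin m → Fin 2 × Fin q → Fin b × Fin n → Cycle (G □ G) ℓ
  C' i (horizontal , j) (k , w) = alongFirst (C i j k) w
  C' i (vertical   , j) (k , w) = alongSecond w (C i j k)

  orient : Fin 2 → Bool → Bool
  orient horizontal e = e
  orient vertical   e = not e

  S' : Fin m → Fin 2 × Fin q → Fin b × Fin n → Subset ℓ
  S' i (dir , j) (k , w) = residues ℓ (2 * period i j k) (Half.half i j k (orient dir (side i w)))

  S'⇒ : ∀ i dir j k w {p} → p ∈ S' i (dir , j) (k , w) → p ∈ S i j k × lower i j k p ≡ orient dir (side i w)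
  S'⇒ i dir j k w {p} p∈ =
    toS (⇒residues in-class) ,
    Half.half-injective i j k (trans (sym (Half.residue⇒half i j k (toℕ p) in-class)) in-half)
    where
    in-half : toℕ p % (2 * period i j k) ≡ Half.half i j k (orient dir (side i w))
    in-half = residues⇒ p∈
    in-class : toℕ p % period i j k ≡ residue i j k
    in-class = Half.half⇒residue i j k (toℕ p) (orient dir (side i w)) in-half

  ⇒S' : ∀ i dir j k w {p} → p ∈ S i j k → lower i j k p ≡ orient dir (side i w) → p ∈ S' i (dir , j) (k , w)
  ⇒S' i dir j k w {p} p∈ lower≡ =
    ⇒residues (trans (Half.residue⇒half i j k (toℕ p) (residues⇒ (fromS p∈))) (cong (Half.half i j k) lower≡))

  -- A vertex never represents both a horizontal and a vertical cycle of the same class: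
  -- the two orientations would put its representative positions in opposite halves.
  not-both-orientations : ∀ i j k w j' k' w' p p' → p ∈ S' i (horizontal , j) (k , w) →
    p' ∈ S' i (vertical , j') (k' , w') →
    vert (C' i (horizontal , j) (k , w)) p ≢ vert (C' i (vertical , j') (k' , w')) p'
  not-both-orientations i j k w j' k' w' p p' p∈ p'∈ e = not-¬ refl (begin
    lower i j k p                      ≡⟨ proj₂ (S'⇒ i horizontal j k w p∈) ⟩
    side i w                           ≡⟨ cong (side i) (cong proj₂ e) ⟩
    side i (vert (C i j' k') p')       ≡⟨ side-spec i j' k' p' (proj₁ (S'⇒ i vertical j' k' w' p'∈)) ⟩
    lower i j' k' p'                   ≡⟨ proj₂ (S'⇒ i vertical j' k' w' p'∈) ⟩
    not (side i w')                    ≡⟨ cong (not ∘ side i) (cong proj₁ e) ⟨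
    not (side i (vert (C i j k) p))    ≡⟨ cong not (side-spec i j k p (proj₁ (S'⇒ i horizontal j k w p∈))) ⟩
    not (lower i j k p)                ∎)

  repDisj' : ∀ i jj kk jj' kk' p p' → p ∈ S' i jj kk → p' ∈ S' i jj' kk' →
             vert (C' i jj kk) p ≡ vert (C' i jj' kk') p' → (jj , kk) ≡ (jj' , kk')
  repDisj' i (horizontal , j) (k , w) (horizontal , j') (k' , w') p p' p∈ p'∈ e
    with refl ← repDisj i j k j' k' p p' (proj₁ (S'⇒ i horizontal j k w p∈))
                          (proj₁ (S'⇒ i horizontal j' k' w' p'∈)) (cong proj₁ e)
       | refl ← cong proj₂ e = refl
  repDisj' i (vertical , j) (k , w) (vertical , j') (k' , w') p p' p∈ p'∈ e
    with refl ← repDisj i j k j' k' p p' (proj₁ (S'⇒ i vertical j k w p∈))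
                          (proj₁ (S'⇒ i vertical j' k' w' p'∈)) (cong proj₂ e)
       | refl ← cong proj₁ e = refl
  repDisj' i (horizontal , j) (k , w) (vertical , j') (k' , w') p p' p∈ p'∈ e =
    contradiction e (not-both-orientations i j k w j' k' w' p p' p∈ p'∈)
  repDisj' i (vertical , j) (k , w) (horizontal , j') (k' , w') p p' p∈ p'∈ e =
    contradiction (sym e) (not-both-orientations i j' k' w' j k w p' p p'∈ p∈)

  -- (x , y) is represented in the horizontal copy through y of the cycle representing x
  -- when x and y lie on the same side, and otherwise in the vertical copy through x of
  -- the cycle representing y.
  repCover' : ∀ i (v : Fin n × Fin n) → Σ[ jj ∈ Fin 2 × Fin q ] Σ[ kk ∈ Fin b × Fin n ]
              Σ[ p ∈ Fin ℓ ] (p ∈ S' i jj kk × vert (C' i jj kk) p ≡ v)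
  repCover' i (x , y) with side i x ≟ᵇ side i y | repCover i x | repCover i y
  ... | yes same   | j , k , p , p∈ , refl | _ =
    (horizontal , j) , (k , y) , p , ⇒S' i horizontal j k y p∈ (trans (sym (side-spec i j k p p∈)) same) , refl
  ... | no differ | _ | j , k , p , p∈ , refl =
    (vertical , j) , (k , x) , p ,
    ⇒S' i vertical j k x p∈ (trans (sym (side-spec i j k p p∈)) (¬-not (differ ∘ sym))) , refl

  grpDisj' : ∀ i jj kk kk' p p' → vert (C' i jj kk) p ≡ vert (C' i jj kk') p' → kk ≡ kk'
  grpDisj' i (horizontal , j) (k , w) (k' , w') p p' e
    with refl ← grpDisj i j k k' p p' (cong proj₁ e) | refl ← cong proj₂ e = refl
  grpDisj' i (vertical , j) (k , w) (k' , w') p p' e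
    with refl ← grpDisj i j k k' p p' (cong proj₂ e) | refl ← cong proj₁ e = refl

  grpCover' : ∀ i jj (v : Fin n × Fin n) → Σ[ kk ∈ Fin b × Fin n ] Σ[ p ∈ Fin ℓ ] vert (C' i jj kk) p ≡ v
  grpCover' i (horizontal , j) (x , y) =
    let (k , p , covers) = grpCover i j x in (k , y) , p , cong (_, y) covers
  grpCover' i (vertical   , j) (x , y) =
    let (k , p , covers) = grpCover i j y in (k , x) , p , cong (x ,_) covers

  decomp' : IsDecomposition (G □ G) {I = Fin m × (Fin 2 × Fin q) × (Fin b × Fin n)}
                                    (λ { (i , jj , kk) → C' i jj kk })
  decomp' = reindex {C = productCycles C₀ C₀} (λ { (i , jj , kk) → C' i jj kk }) layers↔ layer≡
                    (□-decomposition decomp decomp)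
    where
    C₀ : Fin m × Fin q × Fin b → Cycle G ℓ
    C₀ (i , j , k) = C i j k
    layer≡ : ∀ x → let (i , jj , kk) = x in C' i jj kk ≡ productCycles C₀ C₀ (Inverse.to layers↔ x)
    layer≡ (i , (horizontal , j) , (k , w)) = refl
    layer≡ (i , (vertical   , j) , (k , w)) = refl

  size' : ∀ i jj kk → ∣ S' i jj kk ∣ ≡ K
  size' i (dir , j) (k , w) =
    ∣residues∣ K _ _ (ℓ≡K*2period i j k) (Half.half<2d i j k (orient dir (side i w)))

  dr' : ∀ i jj kk → IsDR (C' i jj kk) (S' i jj kk)
  dr' i (dir , j) (k , w) =
    residues-isDR (C' i (dir , j) (k , w)) (2 * period i j k) _ (divides K (ℓ≡K*2period i j k))

  splitting : 2 ≤ K → Splitting (G □ G) ℓ m (Fin 2 × Fin q) (Fin b × Fin n)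
  splitting 2≤K = record
    { C        = C'
    ; S        = S'
    ; decomp   = decomp'
    ; size     = λ i → K , 2≤K , size' i
    ; repDisj  = repDisj'
    ; repCover = repCover'
    ; grpDisj  = grpDisj'
    ; grpCover = grpCover'
    ; dr       = dr'
    }

proposition12 : (n a b ℓ : ℕ) (G : Graph (Fin n)) →
    DRSplittableCycleDecomposition G a b ℓ →
    (Σ[ k ∈ ℕ ] (n ≡ (2 * k) * a × 2 < 2 * k)) →
    DRSplittableCycleDecomposition (G □ G) (2 * a * n) (b * n) ℓ
proposition12 n a b ℓ G dec (K , n≡2K*a , 2<2K) =
  fromSplitting (Construction.splitting dec K n≡2K*a 2≤K) *↔× *↔× 2an≥1 m≥1 2an≡2q*bn
  where
  open DRSplittableCycleDecomposition dec using (q; m≥1; a≥1; a≡q*b)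
  2≤K : 2 ≤ K
  2≤K = *-cancelˡ-< 2 1 K 2<2K
  instance
    a≢0 : NonZero a
    a≢0 = >-nonZero a≥1
    2K≢0 : NonZero (2 * K)
    2K≢0 = >-nonZero (<-trans z<s 2<2K)
    n≢0 : NonZero n
    n≢0 = subst NonZero (sym n≡2K*a) (m*n≢0 (2 * K) a)
  2an≥1 : 1 ≤ 2 * a * n
  2an≥1 = >-nonZero⁻¹ (2 * a * n) {{m*n≢0 (2 * a) n {{m*n≢0 2 a}}}}
  2an≡2q*bn : 2 * a * n ≡ 2 * q * (b * n)
  2an≡2q*bn = begin
    2 * a * n        ≡⟨ cong (λ x → 2 * x * n) a≡q*b ⟩
    2 * (q * b) * n  ≡⟨ cong (_* n) (*-assoc 2 q b) ⟨
    2 * q * b * n    ≡⟨ *-assoc (2 * q) b n ⟩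
    2 * q * (b * n)  ∎
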